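{- Let $m\ge4$ and let $A$ be an independent set of vertices in $H_m$. Then $|A|\le 2m+\sum_{i\in\mathbb{Z}_m}\chi[A_1(i)\ne\emptyset]$.
   Context: For $m\ge4$, $H_m$ is the $4$-graph with vertex set $\mathbb{Z}_m\times\mathbb{Z}_2^2\times\mathbb{Z}_2^2\times\mathbb{Z}_2^2$, vertices written $(i,x,y,z)$, in which four distinct vertices form an edge iff they can be labeled $v_1,v_2,v_3,v_4$ so that one of the following holds (indices $i$ in $\mathbb{Z}_m$): (1) $v_t=(i,x,y,z_t)$ for $t=1,2,3,4$; (2) $v_t=(i,x_t,y_t,z_t)$ for $t=1,\dots,4$, with $x_1+x_2+x_3+x_4=0$ and $(x_k,y_k)\ne(x_l,y_l)$ for $k\ne l$; (3) $v_1=(i,x_1,y_1',z_1')$, $v_2=(i,x_1,y_1'',z_1'')$, $v_3=(i+1,x_2',y_2',z_2')$, $v_4=(i+1,x_2'',y_2'',z_2'')$ with $y_1'\ne y_1''$ and $y_1'+y_1''+x_2'+x_2''=0$; (4) $v_1=(i,x_1,y_1,z_1')$, $v_2=(i,x_1,y_1,z_1'')$ with $z_1'\ne z_1''$, and either (a) $v_3=(i,x_2,y_2,z_2')$, $v_4=(i,x_2,y_2,z_2'')$ with $(x_1,y_1)\ne(x_2,y_2)$ and $z_2'\ne z_2''$; or (b) $v_3=(i+2,x_2,y_2',z_2')$, $v_4=(i+2,x_2,y_2'',z_2'')$ with $y_2'\ne y_2''$; or (c) $v_3=(i+3,x_2',y_2',z_2')$, $v_4=(i+3,x_2'',y_2'',z_2'')$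 with $z_1'+z_1''+x_2'+x_2''=0$. A vertex set is independent if it contains no edge. For a vertex set $A$: $A_1(i)=\{x\in\mathbb{Z}_2^2:\exists y,z,\ (i,x,y,z)\in A\}$. $\chi[B]$ is $1$ if condition $B$ holds and $0$ otherwise. -}

module Defs where

open import Data.Bool using (Bool; true; false; _xor_; if_then_else_)
open import Data.Nat using (ℕ; zero; suc; _+_; _%_)
open import Data.Nat.DivMod using (m%n<n)
open import Data.Fin using (Fin; toℕ; fromℕ<)
open import Data.Product using (_×_; _,_)
open import Data.List using (List; map; allFin)
open import Data.Nat.ListAction using (sum)
open import Data.List.Membership.Propositional using (_∈_)
open import Data.List.Relation.Unary.Any using (Any; any?)
open import Relation.Binary.PropositionalEquality using (_≡_; _≢_)
open import Relation.Nullary using (¬_; Dec; does)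
open import Data.Sum using (_⊎_)

-- ℤ₂² as pairs of booleans with componentwise xor as addition
Z2² : Set
Z2² = Bool × Bool

_⊕_ : Z2² → Z2² → Z2²
(a , b) ⊕ (c , d) = (a xor c , b xor d)

0² : Z2²
0² = (false , false)

_+ₘ_ : {m : ℕ} → Fin m → ℕ → Fin m
_+ₘ_ {suc n} i k = fromℕ< (m%n<n (toℕ i + k) (suc n))

record V (m : ℕ) : Set where
  constructor ⟨_,_,_,_⟩
  field
    idx : Fin m
    x   : Z2²
    y   : Z2²
    z   : Z2²
open V public

Cond1 : {m : ℕ} → V m → V m → V m → V m → Set
Cond1 v₁ v₂ v₃ v₄ =
  idx v₂ ≡ idx v₁ × idx v₃ ≡ idx v₁ × idx v₄ ≡ idx v₁ ×
  x v₂ ≡ x v₁ × x v₃ ≡ x v₁ × x v₄ ≡ x v₁ ×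
  y v₂ ≡ y v₁ × y v₃ ≡ y v₁ × y v₄ ≡ y v₁

xy : {m : ℕ} → V m → Z2² × Z2²
xy v = (x v , y v)

Cond2 : {m : ℕ} → V m → V m → V m → V m → Set
Cond2 v₁ v₂ v₃ v₄ =
  idx v₂ ≡ idx v₁ × idx v₃ ≡ idx v₁ × idx v₄ ≡ idx v₁ ×
  ((x v₁ ⊕ x v₂) ⊕ (x v₃ ⊕ x v₄)) ≡ 0² ×
  xy v₁ ≢ xy v₂ × xy v₁ ≢ xy v₃ × xy v₁ ≢ xy v₄ ×
  xy v₂ ≢ xy v₃ × xy v₂ ≢ xy v₄ × xy v₃ ≢ xy v₄

Cond3 : {m : ℕ} → V m → V m → V m → V m → Set
Cond3 v₁ v₂ v₃ v₄ =
  idx v₂ ≡ idx v₁ × x v₂ ≡ x v₁ ×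
  idx v₃ ≡ idx v₁ +ₘ 1 × idx v₄ ≡ idx v₁ +ₘ 1 ×
  y v₁ ≢ y v₂ ×
  ((y v₁ ⊕ y v₂) ⊕ (x v₃ ⊕ x v₄)) ≡ 0²

Cond4a : {m : ℕ} → V m → V m → V m → V m → Set
Cond4a v₁ v₂ v₃ v₄ =
  idx v₃ ≡ idx v₁ × idx v₄ ≡ idx v₁ ×
  x v₄ ≡ x v₃ × y v₄ ≡ y v₃ × xy v₁ ≢ xy v₃ × z v₃ ≢ z v₄

Cond4b : {m : ℕ} → V m → V m → V m → V m → Set
Cond4b v₁ v₂ v₃ v₄ =
  idx v₃ ≡ idx v₁ +ₘ 2 × idx v₄ ≡ idx v₁ +ₘ 2 ×
  x v₄ ≡ x v₃ × y v₃ ≢ y v₄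

Cond4c : {m : ℕ} → V m → V m → V m → V m → Set
Cond4c v₁ v₂ v₃ v₄ =
  idx v₃ ≡ idx v₁ +ₘ 3 × idx v₄ ≡ idx v₁ +ₘ 3 ×
  ((z v₁ ⊕ z v₂) ⊕ (x v₃ ⊕ x v₄)) ≡ 0²

Cond4 : {m : ℕ} → V m → V m → V m → V m → Set
Cond4 v₁ v₂ v₃ v₄ =
  idx v₂ ≡ idx v₁ × x v₂ ≡ x v₁ × y v₂ ≡ y v₁ × z v₁ ≢ z v₂ ×
  (Cond4a v₁ v₂ v₃ v₄ ⊎ Cond4b v₁ v₂ v₃ v₄ ⊎ Cond4c v₁ v₂ v₃ v₄)

EdgeCond : {m : ℕ} → V m → V m → V m → V m → Set
EdgeCond v₁ v₂ v₃ v₄ =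
  Cond1 v₁ v₂ v₃ v₄ ⊎ Cond2 v₁ v₂ v₃ v₄ ⊎ Cond3 v₁ v₂ v₃ v₄ ⊎ Cond4 v₁ v₂ v₃ v₄

-- A (a duplicate-free list of vertices) is independent: no four distinct
-- members of A, in any labelling, satisfy an edge condition.
Independent : {m : ℕ} → List (V m) → Set
Independent {m} A = ∀ {v₁ v₂ v₃ v₄ : V m} →
  v₁ ∈ A → v₂ ∈ A → v₃ ∈ A → v₄ ∈ A →
  v₁ ≢ v₂ → v₁ ≢ v₃ → v₁ ≢ v₄ → v₂ ≢ v₃ → v₂ ≢ v₄ → v₃ ≢ v₄ →
  ¬ EdgeCond v₁ v₂ v₃ v₄

χ : {P : Set} → Dec P → ℕ
χ d = if does d then 1 else 0

A₁nonempty? : {m : ℕ} → (A : List (V m)) → (i : Fin m) → Dec (Any (λ v → idx v ≡ i) A)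
A₁nonempty? A i = any? (λ v → idx v Data.Fin.≟ i) A

occupied : {m : ℕ} → List (V m) → ℕ
occupied {m} A = sum (map (λ i → χ (A₁nonempty? A i)) (allFin m))

-- Split A into its layers A(i) = {v ∈ A : idx v = i}.  A layer carries three two-level counters, each
-- of the form χ[some class shows two distinct values] + χ[some class shows three distinct values]:
-- x-spread (the values x in the whole layer), y-spread (the values y within one x-class) and z-spread
-- (the values z within one xy-class).  In a nonempty layer every further vertex raises one counter, for
-- otherwise it completes an edge of type (1), (2) or (4a) inside the layer; hence
-- |A(i)| ≤ χ[A(i) ≠ ∅] + z-spread(i) + y-spread(i) + x-spread(i).  Edges of types (4b), (4c) and (3)
-- give z-spread(i) + y-spread(i+2) + x-spread(i+3) ≤ 2: the pairwise sums of three distinct elements of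
-- ℤ₂² are all its nonzero elements, so two distinct values on one layer and three on the other always
-- contain two pairs with equal sums, and these span an edge.  Summing over i ∈ ℤ_m, where shifting by 2
-- or 3 permutes ℤ_m, gives |A| ≤ Σᵢ χ[A(i) ≠ ∅] + 2m.

module Submission where

open import Defs
open import Data.Bool using (Bool; true; false)
import Data.Bool.Properties as Bool
open import Data.Empty using (⊥; ⊥-elim)
open import Data.Fin using (Fin; zero; suc; toℕ; inject₁; fromℕ; _≟_)
open import Data.Fin.Properties using (toℕ-fromℕ<; toℕ-injective; toℕ-inject₁; toℕ-fromℕ; toℕ<n)
open import Data.List using (List; []; _∷_; length; filter; map; allFin; tabulate)
open import Data.List.Properties using (map-tabulate)
open import Data.List.Membership.Propositional using (_∈_; find; lose)
open import Data.List.Membership.Propositional.Properties using (∈-filter⁻)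
open import Data.List.Relation.Binary.Subset.Propositional using (_⊆_)
open import Data.List.Relation.Unary.All using (All)
import Data.List.Relation.Unary.All as All
open import Data.List.Relation.Unary.AllPairs using (_∷_)
open import Data.List.Relation.Unary.Any using (Any; any?; here; there)
open import Data.List.Relation.Unary.Unique.Propositional using (Unique)
import Data.List.Relation.Unary.Unique.Propositional.Properties as Unique
open import Data.Nat using (ℕ; zero; suc; _+_; _*_; _%_; _/_; _≤_; _<_; z≤n; s≤s; NonZero)
open import Data.Nat.DivMod using (%-distribˡ-+; m%n%n≡m%n; m<n⇒m%n≡m; n%n≡0; m≡m%n+[m/n]*n)
open import Data.Nat.Divisibility using (_∣_; divides; >⇒∤)
import Data.Nat.ListAction as ListAction
open import Data.Nat.Properties
  using (≤-refl; ≤-trans; <-trans; n<1+n; +-mono-≤; +-mono-<-≤; +-mono-≤-<; +-monoʳ-≤; +-assoc; +-comm;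
         +-cancelˡ-≡; +-identityʳ; *-comm; +-0-commutativeMonoid; module ≤-Reasoning)
open import Algebra.Properties.CommutativeMonoid.Sum +-0-commutativeMonoid
  using (sum; sum-syntax; sum-cong-≗; sum-init-last; sum-replicate-zero; ∑-distrib-+)
open import Data.Product using (_×_; _,_; ∃-syntax; proj₁; proj₂)
open import Data.Product.Properties using (≡-dec; ,-injectiveˡ; ,-injectiveʳ)
open import Data.Sum using (_⊎_; inj₁; inj₂)
open import Data.Unit using (tt)
import Data.Unit.Properties as Unit
open import Function using (const; _∘_; id)
open import Relation.Binary.Definitions using (DecidableEquality)
open import Relation.Binary.PropositionalEquality
  using (_≡_; _≢_; refl; sym; trans; subst; cong; cong₂; ≢-sym; module ≡-Reasoning)
open import Relation.Nullary using (¬_; Dec; yes; no; ¬?; does)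
open import Relation.Nullary.Decidable using (map′; toWitness; decidable-stable; _×-dec_; _⊎-dec_; _→-dec_)
open import Relation.Unary using (Decidable)

-- Distinctness and arithmetic in ℤ₂²

Distinct₃ : {A : Set} → A → A → A → Set
Distinct₃ a b c = a ≢ b × a ≢ c × b ≢ c

Distinct₄ : {A : Set} → A → A → A → A → Set
Distinct₄ a b c d = a ≢ b × a ≢ c × a ≢ d × b ≢ c × b ≢ d × c ≢ d

Distinct₄-map : {X Y : Set} (f : X → Y) {a b c d : X} →
  Distinct₄ (f a) (f b) (f c) (f d) → Distinct₄ a b c d
Distinct₄-map f (ab , ac , ad , bc , bd , cd) =
  ab ∘ cong f , ac ∘ cong f , ad ∘ cong f , bc ∘ cong f , bd ∘ cong f , cd ∘ cong f

≢⇒,≢ˡ : {P Q : Set} {p p′ : P} {q q′ : Q} → p ≢ p′ → (p , q) ≢ (p′ , q′)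
≢⇒,≢ˡ p≢p′ = p≢p′ ∘ ,-injectiveˡ

≢⇒,≢ʳ : {P Q : Set} {p p′ : P} {q q′ : Q} → q ≢ q′ → (p , q) ≢ (p′ , q′)
≢⇒,≢ʳ q≢q′ = q≢q′ ∘ ,-injectiveʳ

_≟²_ : DecidableEquality Z2²
_≟²_ = ≡-dec Bool._≟_ Bool._≟_

_≟xy_ : DecidableEquality (Z2² × Z2²)
_≟xy_ = ≡-dec _≟²_ _≟²_

distinct₃? : (a b c : Z2²) → Dec (Distinct₃ a b c)
distinct₃? a b c = ¬? (a ≟² b) ×-dec ¬? (a ≟² c) ×-dec ¬? (b ≟² c)

distinct₄? : (a b c d : Z2²) → Dec (Distinct₄ a b c d)
distinct₄? a b c d =
  ¬? (a ≟² b) ×-dec ¬? (a ≟² c) ×-dec ¬? (a ≟² d) ×-dec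
  ¬? (b ≟² c) ×-dec ¬? (b ≟² d) ×-dec ¬? (c ≟² d)

∀-Bool? : {P : Bool → Set} → Decidable P → Dec (∀ b → P b)
∀-Bool? {P} P? = map′ both (λ h → h false , h true) (P? false ×-dec P? true)
  where
  both : P false × P true → ∀ b → P b
  both (pf , pt) false = pf
  both (pf , pt) true = pt

-- ℤ₂² is finite, so the identities below are proved by running this decision procedure.
∀-Z2²? : {P : Z2² → Set} → Decidable P → Dec (∀ a → P a)
∀-Z2²? P? =
  map′ (λ h (a , b) → h a b) (λ h a b → h (a , b)) (∀-Bool? λ a → ∀-Bool? λ b → P? (a , b))

⊕-self : ∀ a → a ⊕ a ≡ 0²
⊕-self = toWitness {a? = ∀-Z2²? λ a → (a ⊕ a) ≟² 0²} _

≡⇒⊕≡0² : {a b : Z2²} → a ≡ b → a ⊕ b ≡ 0²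
≡⇒⊕≡0² {a} refl = ⊕-self a

-- Evaluating these proofs is expensive, so they are kept from unfolding in later type checking.
abstract
  -- Four distinct elements are all of ℤ₂², and the elements of ℤ₂² sum to 0.
  Distinct₄⇒sum≡0² : ∀ a b c d → Distinct₄ a b c d → (a ⊕ b) ⊕ (c ⊕ d) ≡ 0²
  Distinct₄⇒sum≡0² = toWitness {a? =
    ∀-Z2²? λ a → ∀-Z2²? λ b → ∀-Z2²? λ c → ∀-Z2²? λ d →
      distinct₄? a b c d →-dec ((a ⊕ b) ⊕ (c ⊕ d)) ≟² 0²} _

  -- The pairwise sums of three distinct elements of ℤ₂² are the three nonzero elements.
  pair-sum-covered : ∀ u v p q r → u ≢ v → Distinct₃ p q r →
    u ⊕ v ≡ p ⊕ q ⊎ u ⊕ v ≡ p ⊕ r ⊎ u ⊕ v ≡ q ⊕ r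
  pair-sum-covered = toWitness {a? =
    ∀-Z2²? λ u → ∀-Z2²? λ v → ∀-Z2²? λ p → ∀-Z2²? λ q → ∀-Z2²? λ r →
      ¬? (u ≟² v) →-dec (distinct₃? p q r →-dec
        ((u ⊕ v) ≟² (p ⊕ q) ⊎-dec (u ⊕ v) ≟² (p ⊕ r) ⊎-dec (u ⊕ v) ≟² (q ⊕ r)))} _

-- Two-level counters and spreads

χ-yes : {P : Set} (d : Dec P) → P → χ d ≡ 1
χ-yes (yes _) _ = refl
χ-yes (no ¬p) p = ⊥-elim (¬p p)

χ-no : {P : Set} (d : Dec P) → ¬ P → χ d ≡ 0
χ-no (yes p) ¬p = ⊥-elim (¬p p)
χ-no (no _) _ = refl

χ-mono : {P Q : Set} (d : Dec P) (e : Dec Q) → (P → Q) → χ d ≤ χ e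
χ-mono (yes p) (yes _) _ = ≤-refl
χ-mono (yes p) (no ¬q) f = ⊥-elim (¬q (f p))
χ-mono (no _) _ _ = z≤n

counter-grows : {P₂ P₃ Q₂ Q₃ : Set}
  (p₂ : Dec P₂) (p₃ : Dec P₃) (q₂ : Dec Q₂) (q₃ : Dec Q₃) →
  ¬ P₃ → Q₂ → (P₂ → Q₃) → suc (χ p₂ + χ p₃) ≤ χ q₂ + χ q₃
counter-grows _ (yes p₃) _ _ ¬p₃ _ _ = ⊥-elim (¬p₃ p₃)
counter-grows _ _ (no ¬q₂) _ _ q₂ _ = ⊥-elim (¬q₂ q₂)
counter-grows (yes p₂) (no _) (yes _) (yes _) _ _ _ = ≤-refl
counter-grows (yes p₂) (no _) (yes _) (no ¬q₃) _ _ p₂⇒q₃ = ⊥-elim (¬q₃ (p₂⇒q₃ p₂))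
counter-grows (no _) (no _) (yes _) _ _ _ _ = s≤s z≤n

counters-exclusive : {P₂ P₃ Q₂ Q₃ : Set}
  (p₂ : Dec P₂) (p₃ : Dec P₃) (q₂ : Dec Q₂) (q₃ : Dec Q₃) →
  (P₃ → P₂) → (Q₃ → Q₂) → (P₃ → ¬ Q₂) → (P₂ → ¬ Q₃) →
  χ p₂ + χ p₃ + (χ q₂ + χ q₃) ≤ 2
counters-exclusive (no ¬p₂) (yes p₃) _ _ p₃⇒p₂ _ _ _ = ⊥-elim (¬p₂ (p₃⇒p₂ p₃))
counters-exclusive _ _ (no ¬q₂) (yes q₃) _ q₃⇒q₂ _ _ = ⊥-elim (¬q₂ (q₃⇒q₂ q₃))
counters-exclusive (yes p₂) _ _ (yes q₃) _ _ _ excl = ⊥-elim (excl p₂ q₃)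
counters-exclusive _ (yes p₃) (yes q₂) _ _ _ excl _ = ⊥-elim (excl p₃ q₂)
counters-exclusive (no _) (no _) (yes _) (yes _) _ _ _ _ = ≤-refl
counters-exclusive (no _) (no _) (yes _) (no _) _ _ _ _ = s≤s z≤n
counters-exclusive (no _) (no _) (no _) (no _) _ _ _ _ = z≤n
counters-exclusive (yes _) (yes _) (no _) (no _) _ _ _ _ = ≤-refl
counters-exclusive (yes _) (no _) (yes _) (no _) _ _ _ _ = ≤-refl
counters-exclusive (yes _) (no _) (no _) (no _) _ _ _ _ = s≤s z≤n

m+n+o≤2 : {m n o : ℕ} → m ≡ 0 ⊎ n ≡ 0 → m + o ≤ 2 → n + o ≤ 2 → m + n + o ≤ 2
m+n+o≤2 (inj₁ refl) _ n+o≤2 = n+o≤2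
m+n+o≤2 {m} {o = o} (inj₂ refl) m+o≤2 _ = subst (λ t → t + o ≤ 2) (sym (+-identityʳ m)) m+o≤2

module _ {X : Set} where

  SomePair : (X → X → Set) → List X → Set
  SomePair R L = ∃[ a ] ∃[ b ] (a ∈ L × b ∈ L × R a b)

  SomeTriple : (X → X → X → Set) → List X → Set
  SomeTriple R L = ∃[ a ] ∃[ b ] ∃[ c ] (a ∈ L × b ∈ L × c ∈ L × R a b c)

  somePair? : {R : X → X → Set} → (∀ a b → Dec (R a b)) → ∀ L → Dec (SomePair R L)
  somePair? {R} R? L = map′ from to (any? (λ a → any? (R? a) L) L)
    where
    from : Any (λ a → Any (R a) L) L → SomePair R L
    from p with find p
    ... | a , a∈ , q with find q
    ... | b , b∈ , r = a , b , a∈ , b∈ , r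
    to : SomePair R L → Any (λ a → Any (R a) L) L
    to (a , b , a∈ , b∈ , r) = lose a∈ (lose b∈ r)

  someTriple? : {R : X → X → X → Set} → (∀ a b c → Dec (R a b c)) → ∀ L → Dec (SomeTriple R L)
  someTriple? {R} R? L = map′ from to (any? (λ a → any? (λ b → any? (R? a b) L) L) L)
    where
    from : Any (λ a → Any (λ b → Any (R a b) L) L) L → SomeTriple R L
    from p with find p
    ... | a , a∈ , q with find q
    ... | b , b∈ , q′ with find q′
    ... | c , c∈ , r = a , b , c , a∈ , b∈ , c∈ , r
    to : SomeTriple R L → Any (λ a → Any (λ b → Any (R a b) L) L) L
    to (a , b , c , a∈ , b∈ , c∈ , r) = lose a∈ (lose b∈ (lose c∈ r))

  somePair-∷ : {R : X → X → Set} {w : X} {L : List X} → SomePair R L → SomePair R (w ∷ L)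
  somePair-∷ (a , b , a∈ , b∈ , r) = a , b , there a∈ , there b∈ , r

  someTriple-∷ : {R : X → X → X → Set} {w : X} {L : List X} → SomeTriple R L → SomeTriple R (w ∷ L)
  someTriple-∷ (a , b , c , a∈ , b∈ , c∈ , r) = a , b , c , there a∈ , there b∈ , there c∈ , r

module _ {X K : Set} (key : X → K) (val : X → Z2²) where

  Split : X → X → Set
  Split a b = key a ≡ key b × val a ≢ val b

  Split₃ : X → X → X → Set
  Split₃ a b c = key a ≡ key b × key a ≡ key c × Distinct₃ (val a) (val b) (val c)

  Spread₂ Spread₃ : List X → Set
  Spread₂ = SomePair Split
  Spread₃ = SomeTriple Split₃

  Spread₃⇒Spread₂ : {L : List X} → Spread₃ L → Spread₂ L
  Spread₃⇒Spread₂ (a , b , _ , a∈ , b∈ , _ , kab , _ , vab , _) = a , b , a∈ , b∈ , kab , vab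

module _ {X K : Set} (_≟ₖ_ : DecidableEquality K) (key : X → K) (val : X → Z2²) where

  spread₂? : ∀ L → Dec (Spread₂ key val L)
  spread₂? = somePair? λ a b → (key a ≟ₖ key b) ×-dec ¬? (val a ≟² val b)

  spread₃? : ∀ L → Dec (Spread₃ key val L)
  spread₃? = someTriple? λ a b c →
    (key a ≟ₖ key b) ×-dec (key a ≟ₖ key c) ×-dec distinct₃? (val a) (val b) (val c)

  spread : List X → ℕ
  spread L = χ (spread₂? L) + χ (spread₃? L)

  spread≡0 : {L : List X} → ¬ Spread₂ key val L → spread L ≡ 0
  spread≡0 {L} ¬split =
    cong₂ _+_ (χ-no (spread₂? L) ¬split) (χ-no (spread₃? L) (¬split ∘ Spread₃⇒Spread₂ key val))

  spread-mono : (w : X) (L : List X) → spread L ≤ spread (w ∷ L)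
  spread-mono w L = +-mono-≤ (χ-mono (spread₂? L) (spread₂? (w ∷ L)) somePair-∷)
                             (χ-mono (spread₃? L) (spread₃? (w ∷ L)) someTriple-∷)

  spread-grows : {w e : X} {L : List X} → e ∈ L → key e ≡ key w →
    (∀ {v} → v ∈ L → key v ≡ key w → val v ≢ val w) →
    (∀ {a b} → a ∈ L → b ∈ L → Split key val a b → key a ≡ key w) →
    (∀ {a b c} → a ∈ L → b ∈ L → c ∈ L → Split₃ key val a b c → key a ≢ key w) →
    suc (spread L) ≤ spread (w ∷ L)
  spread-grows {w} {e} {L} e∈ ke≡kw w-new in-class-of-w no-fourth =
    counter-grows (spread₂? L) (spread₃? L) (spread₂? (w ∷ L)) (spread₃? (w ∷ L))
      no-triple new-pair pair⇒triple
    where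
    no-triple : ¬ Spread₃ key val L
    no-triple (a , b , c , a∈ , b∈ , c∈ , s@(kab , _ , vab , _)) =
      no-fourth a∈ b∈ c∈ s (in-class-of-w a∈ b∈ (kab , vab))
    new-pair : Spread₂ key val (w ∷ L)
    new-pair = w , e , here refl , there e∈ , sym ke≡kw , λ eq → w-new e∈ ke≡kw (sym eq)
    pair⇒triple : Spread₂ key val L → Spread₃ key val (w ∷ L)
    pair⇒triple (a , b , a∈ , b∈ , kab , vab) =
      w , a , b , here refl , there a∈ , there b∈ , sym ka≡kw , trans (sym ka≡kw) kab ,
      (λ eq → w-new a∈ ka≡kw (sym eq)) , (λ eq → w-new b∈ (trans (sym kab) ka≡kw) (sym eq)) , vab
      where
      ka≡kw : key a ≡ key w
      ka≡kw = in-class-of-w a∈ b∈ (kab , vab)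

module _ {X K : Set} (_≟ₖ_ : DecidableEquality K) (key : X → K) (val val′ : X → Z2²)
         {Lo Hi : List X}
         (sums-differ : ∀ {a b c d} → a ∈ Lo → b ∈ Lo → c ∈ Hi → d ∈ Hi →
                        Split key val a b → val′ c ≢ val′ d →
                        val a ⊕ val b ≢ val′ c ⊕ val′ d) where

  Spread₃-excludes-Spread₂ : Spread₃ key val Lo → ¬ Spread₂ (const tt) val′ Hi
  Spread₃-excludes-Spread₂ (a , b , c , a∈ , b∈ , c∈ , kab , kac , vab , vac , vbc)
                           (d , e , d∈ , e∈ , _ , v′de)
    with pair-sum-covered (val′ d) (val′ e) (val a) (val b) (val c) v′de (vab , vac , vbc)
  ... | inj₁ eq = sums-differ a∈ b∈ d∈ e∈ (kab , vab) v′de (sym eq)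
  ... | inj₂ (inj₁ eq) = sums-differ a∈ c∈ d∈ e∈ (kac , vac) v′de (sym eq)
  ... | inj₂ (inj₂ eq) = sums-differ b∈ c∈ d∈ e∈ (trans (sym kab) kac , vbc) v′de (sym eq)

  Spread₂-excludes-Spread₃ : Spread₂ key val Lo → ¬ Spread₃ (const tt) val′ Hi
  Spread₂-excludes-Spread₃ (a , b , a∈ , b∈ , kab , vab)
                           (c , d , e , c∈ , d∈ , e∈ , _ , _ , v′cd , v′ce , v′de)
    with pair-sum-covered (val a) (val b) (val′ c) (val′ d) (val′ e) vab (v′cd , v′ce , v′de)
  ... | inj₁ eq = sums-differ a∈ b∈ c∈ d∈ (kab , vab) v′cd eq
  ... | inj₂ (inj₁ eq) = sums-differ a∈ b∈ c∈ e∈ (kab , vab) v′ce eq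
  ... | inj₂ (inj₂ eq) = sums-differ a∈ b∈ d∈ e∈ (kab , vab) v′de eq

  spreads-exclusive : spread _≟ₖ_ key val Lo + spread Unit._≟_ (const tt) val′ Hi ≤ 2
  spreads-exclusive =
    counters-exclusive (spread₂? _≟ₖ_ key val Lo) (spread₃? _≟ₖ_ key val Lo)
      (spread₂? Unit._≟_ (const tt) val′ Hi) (spread₃? Unit._≟_ (const tt) val′ Hi)
      (Spread₃⇒Spread₂ key val) (Spread₃⇒Spread₂ (const tt) val′)
      Spread₃-excludes-Spread₂ Spread₂-excludes-Spread₃

-- Rotations of ℤ_m and sums over it

module _ {n : ℕ} where

  private
    M : ℕ
    M = suc n

  toℕ-+ₘ : (i : Fin M) (k : ℕ) → toℕ (i +ₘ k) ≡ (toℕ i + k) % M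
  toℕ-+ₘ i k = toℕ-fromℕ< _

  +ₘ-+ₘ : (i : Fin M) (k l : ℕ) → (i +ₘ k) +ₘ l ≡ i +ₘ (k + l)
  +ₘ-+ₘ i k l = toℕ-injective (begin
    toℕ ((i +ₘ k) +ₘ l)             ≡⟨ toℕ-+ₘ (i +ₘ k) l ⟩
    (toℕ (i +ₘ k) + l) % M          ≡⟨ cong (λ t → (t + l) % M) (toℕ-+ₘ i k) ⟩
    ((t + k) % M + l) % M           ≡⟨ %-distribˡ-+ ((t + k) % M) l M ⟩
    ((t + k) % M % M + l % M) % M   ≡⟨ cong (λ u → (u + l % M) % M) (m%n%n≡m%n (t + k) M) ⟩
    ((t + k) % M + l % M) % M       ≡⟨ %-distribˡ-+ (t + k) l M ⟨
    (t + k + l) % M                 ≡⟨ cong (_% M) (+-assoc t k l) ⟩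
    (t + (k + l)) % M               ≡⟨ toℕ-+ₘ i (k + l) ⟨
    toℕ (i +ₘ (k + l))              ∎)
    where
    open ≡-Reasoning
    t : ℕ
    t = toℕ i

  +ₘ-identityʳ : (i : Fin M) → i +ₘ 0 ≡ i
  +ₘ-identityʳ i = toℕ-injective (trans (toℕ-+ₘ i 0)
    (trans (cong (_% M) (+-identityʳ (toℕ i))) (m<n⇒m%n≡m (toℕ<n i))))

  inject₁-+ₘ-1 : (j : Fin n) → inject₁ j +ₘ 1 ≡ suc j
  inject₁-+ₘ-1 j = toℕ-injective (trans (toℕ-+ₘ (inject₁ j) 1)
    (trans (cong (λ t → (t + 1) % M) (toℕ-inject₁ j))
    (trans (cong (_% M) (+-comm (toℕ j) 1)) (m<n⇒m%n≡m (s≤s (toℕ<n j))))))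

  fromℕ-+ₘ-1 : fromℕ n +ₘ 1 ≡ zero
  fromℕ-+ₘ-1 = toℕ-injective (trans (toℕ-+ₘ (fromℕ n) 1)
    (trans (cong (λ t → (t + 1) % M) (toℕ-fromℕ n)) (trans (cong (_% M) (+-comm n 1)) (n%n≡0 M))))

  +ₘ-fixed⇒∣ : (i : Fin M) (k : ℕ) → i ≡ i +ₘ k → M ∣ k
  +ₘ-fixed⇒∣ i k i≡i+k = divides ((t + k) / M) (+-cancelˡ-≡ t k _ (begin
    t + k
      ≡⟨ m≡m%n+[m/n]*n (t + k) M ⟩
    (t + k) % M + (t + k) / M * M
      ≡⟨ cong (_+ (t + k) / M * M) (trans (cong toℕ i≡i+k) (toℕ-+ₘ i k)) ⟨
    t + (t + k) / M * M ∎))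
    where
    open ≡-Reasoning
    t : ℕ
    t = toℕ i

  +ₘ-no-fixpoint : (i : Fin M) (k : ℕ) .{{_ : NonZero k}} → k < M → i ≢ i +ₘ k
  +ₘ-no-fixpoint i k k<M i≡i+k = >⇒∤ k<M (+ₘ-fixed⇒∣ i k i≡i+k)

  ∑-+ₘ-1 : (f : Fin M → ℕ) → ∑[ j < M ] f (j +ₘ 1) ≡ sum f
  ∑-+ₘ-1 f = begin
    ∑[ j < M ] f (j +ₘ 1)
      ≡⟨ sum-init-last (λ j → f (j +ₘ 1)) ⟩
    ∑[ j < n ] f (inject₁ j +ₘ 1) + f (fromℕ n +ₘ 1)
      ≡⟨ cong₂ _+_ (sum-cong-≗ (cong f ∘ inject₁-+ₘ-1)) (cong f fromℕ-+ₘ-1) ⟩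
    ∑[ j < n ] f (suc j) + f zero
      ≡⟨ +-comm _ (f zero) ⟩
    sum f ∎
    where open ≡-Reasoning

  ∑-+ₘ : (k : ℕ) (f : Fin M → ℕ) → ∑[ j < M ] f (j +ₘ k) ≡ sum f
  ∑-+ₘ zero f = sum-cong-≗ (cong f ∘ +ₘ-identityʳ)
  ∑-+ₘ (suc k) f = begin
    ∑[ j < M ] f (j +ₘ suc k)       ≡⟨ sum-cong-≗ (λ j → cong f (+ₘ-+ₘ j 1 k)) ⟨
    ∑[ j < M ] f ((j +ₘ 1) +ₘ k)    ≡⟨ ∑-+ₘ-1 (λ j → f (j +ₘ k)) ⟩
    ∑[ j < M ] f (j +ₘ k)           ≡⟨ ∑-+ₘ k f ⟩
    sum f                           ∎
    where open ≡-Reasoning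

∑-mono-≤ : {n : ℕ} {f g : Fin n → ℕ} → (∀ j → f j ≤ g j) → sum f ≤ sum g
∑-mono-≤ {zero} _ = z≤n
∑-mono-≤ {suc n} f≤g = +-mono-≤ (f≤g zero) (∑-mono-≤ (f≤g ∘ suc))

∑-bounded : {n : ℕ} {f : Fin n → ℕ} (c : ℕ) → (∀ j → f j ≤ c) → sum f ≤ n * c
∑-bounded {zero} c _ = z≤n
∑-bounded {suc n} c f≤c = +-mono-≤ (f≤c zero) (∑-bounded c (f≤c ∘ suc))

∑-indicator : {n : ℕ} (c : Fin n) → ∑[ j < n ] χ (c ≟ j) ≡ 1
∑-indicator {suc n} zero = cong suc (sum-replicate-zero n)
∑-indicator {suc n} (suc c) = ∑-indicator c

sum-tabulate : {n : ℕ} (f : Fin n → ℕ) → ListAction.sum (tabulate f) ≡ sum f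
sum-tabulate {zero} f = refl
sum-tabulate {suc n} f = cong (f zero +_) (sum-tabulate (f ∘ suc))

sum-map-allFin : {n : ℕ} (f : Fin n → ℕ) → ListAction.sum (map f (allFin n)) ≡ sum f
sum-map-allFin f = trans (cong ListAction.sum (map-tabulate id f)) (sum-tabulate f)

length-filter-∷ : {X : Set} {P : X → Set} (P? : Decidable P) (w : X) (xs : List X) →
  length (filter P? (w ∷ xs)) ≡ χ (P? w) + length (filter P? xs)
length-filter-∷ P? w xs with does (P? w)
... | true = refl
... | false = refl

length-partition : {X : Set} {n : ℕ} (f : X → Fin n) (xs : List X) →
  length xs ≡ ∑[ j < n ] length (filter (λ v → f v ≟ j) xs)
length-partition {n = n} f [] = sym (sum-replicate-zero n)
length-partition {n = n} f (w ∷ xs) = sym (begin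
  ∑[ j < n ] length (filter (λ v → f v ≟ j) (w ∷ xs))
    ≡⟨ sum-cong-≗ (λ j → length-filter-∷ (λ v → f v ≟ j) w xs) ⟩
  ∑[ j < n ] (χ (f w ≟ j) + length (filter (λ v → f v ≟ j) xs))
    ≡⟨ ∑-distrib-+ (λ j → χ (f w ≟ j)) (λ j → length (filter (λ v → f v ≟ j) xs)) ⟩
  ∑[ j < n ] χ (f w ≟ j) + ∑[ j < n ] length (filter (λ v → f v ≟ j) xs)
    ≡⟨ cong₂ _+_ (∑-indicator (f w)) (sym (length-partition f xs)) ⟩
  1 + length xs ∎)
  where open ≡-Reasoning

∑-distrib-+₃ : {n : ℕ} (f g h : Fin n → ℕ) → ∑[ j < n ] (f j + g j + h j) ≡ sum f + sum g + sum h
∑-distrib-+₃ f g h = trans (∑-distrib-+ (λ j → f j + g j) h) (cong (_+ sum h) (∑-distrib-+ f g))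

-- Layers of an independent set

module _ {m : ℕ} where

  V-≡ : {a b : V m} → idx a ≡ idx b → xy a ≡ xy b → z a ≡ z b → a ≡ b
  V-≡ {⟨ _ , _ , _ , _ ⟩} {⟨ _ , _ , _ , _ ⟩} refl refl refl = refl

  x-spread y-spread z-spread spreads : List (V m) → ℕ
  x-spread = spread Unit._≟_ (const tt) x
  y-spread = spread _≟²_ x y
  z-spread = spread _≟xy_ xy z
  spreads L = z-spread L + y-spread L + x-spread L

module Layering {m : ℕ} (A : List (V m)) where

  layer : Fin m → List (V m)
  layer i = filter (λ v → idx v ≟ i) A

  ∈-layer⁻ : {i : Fin m} {v : V m} → v ∈ layer i → v ∈ A × idx v ≡ i
  ∈-layer⁻ {i = i} = ∈-filter⁻ (λ v → idx v ≟ i)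

  in-A : {i : Fin m} {v : V m} → v ∈ layer i → v ∈ A
  in-A = proj₁ ∘ ∈-layer⁻

  same-idx : {i : Fin m} {a b : V m} → a ∈ layer i → b ∈ layer i → idx b ≡ idx a
  same-idx a∈ b∈ = trans (proj₂ (∈-layer⁻ b∈)) (sym (proj₂ (∈-layer⁻ a∈)))

  layer-shift : {j j′ : Fin m} {k : ℕ} {a c : V m} →
    a ∈ layer j → c ∈ layer j′ → j′ ≡ j +ₘ k → idx c ≡ idx a +ₘ k
  layer-shift {k = k} a∈ c∈ j′≡j+k =
    trans (proj₂ (∈-layer⁻ c∈)) (trans j′≡j+k (cong (_+ₘ k) (sym (proj₂ (∈-layer⁻ a∈)))))

  layers-apart : {j j′ : Fin m} {a c : V m} → a ∈ layer j → c ∈ layer j′ → j ≢ j′ → a ≢ c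
  layers-apart a∈ c∈ j≢j′ a≡c =
    j≢j′ (trans (sym (proj₂ (∈-layer⁻ a∈))) (trans (cong idx a≡c) (proj₂ (∈-layer⁻ c∈))))

  layers-distinct : {j j′ : Fin m} {a b c d : V m} →
    a ∈ layer j → b ∈ layer j → c ∈ layer j′ → d ∈ layer j′ → j ≢ j′ → a ≢ b → c ≢ d →
    Distinct₄ a b c d
  layers-distinct a∈ b∈ c∈ d∈ j≢j′ a≢b c≢d =
    a≢b , layers-apart a∈ c∈ j≢j′ , layers-apart a∈ d∈ j≢j′ ,
    layers-apart b∈ c∈ j≢j′ , layers-apart b∈ d∈ j≢j′ , c≢d

module _ {m : ℕ} {A : List (V m)} (independent : Independent A) where

  no-edge : {a b c d : V m} → a ∈ A → b ∈ A → c ∈ A → d ∈ A →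
    Distinct₄ a b c d → ¬ EdgeCond a b c d
  no-edge a∈ b∈ c∈ d∈ (ab , ac , ad , bc , bd , cd) = independent a∈ b∈ c∈ d∈ ab ac ad bc bd cd

module WithinLayer {m : ℕ} {A : List (V m)} (independent : Independent A) (i : Fin m) where

  open Layering A

  no-Cond1 : {a b c d : V m} → a ∈ layer i → b ∈ layer i → c ∈ layer i → d ∈ layer i →
    xy b ≡ xy a → xy c ≡ xy a → xy d ≡ xy a → Distinct₄ a b c d → ⊥
  no-Cond1 a∈ b∈ c∈ d∈ qb qc qd distinct =
    no-edge independent (in-A a∈) (in-A b∈) (in-A c∈) (in-A d∈) distinct
      (inj₁ (same-idx a∈ b∈ , same-idx a∈ c∈ , same-idx a∈ d∈ ,
             cong proj₁ qb , cong proj₁ qc , cong proj₁ qd ,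
             cong proj₂ qb , cong proj₂ qc , cong proj₂ qd))

  no-Cond2 : {a b c d : V m} → a ∈ layer i → b ∈ layer i → c ∈ layer i → d ∈ layer i →
    Distinct₄ (xy a) (xy b) (xy c) (xy d) → (x a ⊕ x b) ⊕ (x c ⊕ x d) ≢ 0²
  no-Cond2 {a} {b} {c} {d} a∈ b∈ c∈ d∈ distinct sum≡0 =
    no-edge independent (in-A a∈) (in-A b∈) (in-A c∈) (in-A d∈) (Distinct₄-map xy distinct)
      (inj₂ (inj₁ (same-idx a∈ b∈ , same-idx a∈ c∈ , same-idx a∈ d∈ , sum≡0 , distinct)))

  no-Cond2-pairs : {a b c d : V m} → a ∈ layer i → b ∈ layer i → c ∈ layer i → d ∈ layer i →
    x a ≡ x b → x c ≡ x d → ¬ Distinct₄ (xy a) (xy b) (xy c) (xy d)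
  no-Cond2-pairs a∈ b∈ c∈ d∈ xab xcd distinct =
    no-Cond2 a∈ b∈ c∈ d∈ distinct (≡⇒⊕≡0² (trans (≡⇒⊕≡0² xab) (sym (≡⇒⊕≡0² xcd))))

  no-Cond4a : {a b c d : V m} → a ∈ layer i → b ∈ layer i → c ∈ layer i → d ∈ layer i →
    xy b ≡ xy a → z a ≢ z b → xy d ≡ xy c → z c ≢ z d → xy a ≢ xy c → ⊥
  no-Cond4a a∈ b∈ c∈ d∈ xyab zab xycd zcd xyac =
    no-edge independent (in-A a∈) (in-A b∈) (in-A c∈) (in-A d∈)
      (zab ∘ cong z , xyac ∘ cong xy , (λ a≡d → xyac (trans (cong xy a≡d) xycd)) ,
       (λ b≡c → xyac (trans (sym xyab) (cong xy b≡c))) ,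
       (λ b≡d → xyac (trans (sym xyab) (trans (cong xy b≡d) xycd))) , zcd ∘ cong z)
      (inj₂ (inj₂ (inj₂ (same-idx a∈ b∈ , cong proj₁ xyab , cong proj₂ xyab , zab ,
        inj₁ (same-idx a∈ c∈ , same-idx a∈ d∈ , cong proj₁ xycd , cong proj₂ xycd , xyac , zcd)))))

  module _ {w : V m} {L : List (V m)} (w∷L⊆ : w ∷ L ⊆ layer i) (w∉L : All (w ≢_) L) where

    private
      w∈ : w ∈ layer i
      w∈ = w∷L⊆ (here refl)

      L⊆ : L ⊆ layer i
      L⊆ = w∷L⊆ ∘ there

    x-spread-grows : {e : V m} → e ∈ L → (∀ {v} → v ∈ L → x v ≢ x w) →
      suc (x-spread L) ≤ x-spread (w ∷ L)
    x-spread-grows e∈ new-x =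
      spread-grows Unit._≟_ (const tt) x e∈ refl (λ v∈ _ → new-x v∈) (λ _ _ _ → refl) no-fourth
      where
      no-fourth : ∀ {a b c} → a ∈ L → b ∈ L → c ∈ L → Split₃ (const tt) x a b c → tt ≢ tt
      no-fourth {a} {b} {c} a∈ b∈ c∈ (_ , _ , xab , xac , xbc) _ =
        no-Cond2 (L⊆ a∈) (L⊆ b∈) (L⊆ c∈) w∈ (Distinct₄-map proj₁ distinct)
          (Distinct₄⇒sum≡0² _ _ _ _ distinct)
        where
        distinct : Distinct₄ (x a) (x b) (x c) (x w)
        distinct = xab , xac , new-x a∈ , xbc , new-x b∈ , new-x c∈

    y-spread-grows : {e : V m} → e ∈ L → x e ≡ x w → (∀ {v} → v ∈ L → xy v ≢ xy w) →
      suc (y-spread L) ≤ y-spread (w ∷ L)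
    y-spread-grows {e} e∈ xe≡xw new-xy =
      spread-grows _≟²_ x y e∈ xe≡xw (λ v∈ xv≡xw → new-xy v∈ ∘ cong₂ _,_ xv≡xw) in-class no-fourth
      where
      in-class : ∀ {a b} → a ∈ L → b ∈ L → Split x y a b → x a ≡ x w
      in-class {a} {b} a∈ b∈ (xab , yab) = decidable-stable (x a ≟² x w) λ xa≢xw →
        no-Cond2-pairs (L⊆ a∈) (L⊆ b∈) (L⊆ e∈) w∈ xab xe≡xw
          (≢⇒,≢ʳ yab , ≢⇒,≢ˡ (λ xa≡xe → xa≢xw (trans xa≡xe xe≡xw)) , ≢⇒,≢ˡ xa≢xw ,
           ≢⇒,≢ˡ (λ xb≡xe → xa≢xw (trans xab (trans xb≡xe xe≡xw))) ,
           ≢⇒,≢ˡ (λ xb≡xw → xa≢xw (trans xab xb≡xw)) , new-xy e∈)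
      no-fourth : ∀ {a b c} → a ∈ L → b ∈ L → c ∈ L → Split₃ x y a b c → x a ≢ x w
      no-fourth a∈ b∈ c∈ (xab , xac , yab , yac , ybc) xa≡xw =
        no-Cond2-pairs (L⊆ a∈) (L⊆ b∈) (L⊆ c∈) w∈ xab (trans (sym xac) xa≡xw)
          (≢⇒,≢ʳ yab , ≢⇒,≢ʳ yac , new-xy a∈ , ≢⇒,≢ʳ ybc , new-xy b∈ , new-xy c∈)

    z-spread-grows : {e : V m} → e ∈ L → xy e ≡ xy w → suc (z-spread L) ≤ z-spread (w ∷ L)
    z-spread-grows {e} e∈ xye≡xyw = spread-grows _≟xy_ xy z e∈ xye≡xyw new-z in-class no-fourth
      where
      w≢ : ∀ {v} → v ∈ L → v ≢ w
      w≢ v∈ = ≢-sym (All.lookup w∉L v∈)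
      new-z : ∀ {v} → v ∈ L → xy v ≡ xy w → z v ≢ z w
      new-z v∈ xyv≡xyw zv≡zw = w≢ v∈ (V-≡ (same-idx w∈ (L⊆ v∈)) xyv≡xyw zv≡zw)
      in-class : ∀ {a b} → a ∈ L → b ∈ L → Split xy z a b → xy a ≡ xy w
      in-class {a} a∈ b∈ (xyab , zab) = decidable-stable (xy a ≟xy xy w) λ xya≢xyw →
        no-Cond4a (L⊆ a∈) (L⊆ b∈) (L⊆ e∈) w∈ (sym xyab) zab (sym xye≡xyw) (new-z e∈ xye≡xyw)
          (λ xya≡xye → xya≢xyw (trans xya≡xye xye≡xyw))
      no-fourth : ∀ {a b c} → a ∈ L → b ∈ L → c ∈ L → Split₃ xy z a b c → xy a ≢ xy w
      no-fourth a∈ b∈ c∈ (xyab , xyac , zab , zac , zbc) xya≡xyw =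
        no-Cond1 (L⊆ a∈) (L⊆ b∈) (L⊆ c∈) w∈ (sym xyab) (sym xyac) (sym xya≡xyw)
          (zab ∘ cong z , zac ∘ cong z , w≢ a∈ , zbc ∘ cong z , w≢ b∈ , w≢ c∈)

    private
      x-mono : x-spread L ≤ x-spread (w ∷ L)
      x-mono = spread-mono Unit._≟_ (const tt) x w L
      y-mono : y-spread L ≤ y-spread (w ∷ L)
      y-mono = spread-mono _≟²_ x y w L
      z-mono : z-spread L ≤ z-spread (w ∷ L)
      z-mono = spread-mono _≟xy_ xy z w L

    spreads-grow : {e : V m} → e ∈ L → suc (spreads L) ≤ spreads (w ∷ L)
    spreads-grow e∈ with any? (λ v → x v ≟² x w) L
    ... | no no-x-match =
      +-mono-≤-< (+-mono-≤ z-mono y-mono)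
        (x-spread-grows e∈ λ v∈ xv≡xw → no-x-match (lose v∈ xv≡xw))
    ... | yes x-match with find x-match | any? (λ v → xy v ≟xy xy w) L
    ...   | e′ , e′∈ , xe′≡xw | no no-xy-match =
      +-mono-<-≤ (+-mono-≤-< z-mono
        (y-spread-grows e′∈ xe′≡xw λ v∈ xyv≡xyw → no-xy-match (lose v∈ xyv≡xyw))) x-mono
    ...   | _ | yes xy-match with find xy-match
    ...     | e″ , e″∈ , xye″≡xyw =
      +-mono-<-≤ (+-mono-<-≤ (z-spread-grows e″∈ xye″≡xyw) y-mono) x-mono

  spreads-bound : {w : V m} {L : List (V m)} → Unique (w ∷ L) → w ∷ L ⊆ layer i →
    length (w ∷ L) ≤ suc (spreads (w ∷ L))
  spreads-bound {L = []} _ _ = s≤s z≤n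
  spreads-bound {L = e ∷ L} (w∉ ∷ unique) w∷L⊆ =
    s≤s (≤-trans (spreads-bound unique (w∷L⊆ ∘ there)) (spreads-grow w∷L⊆ w∉ (here refl)))

  sublayer-bound : (L : List (V m)) → Unique L → L ⊆ layer i →
    length L ≤ χ (A₁nonempty? A i) + spreads L
  sublayer-bound [] _ _ = z≤n
  sublayer-bound (w ∷ L) unique w∷L⊆ =
    subst (λ c → length (w ∷ L) ≤ c + spreads (w ∷ L)) (sym (χ-yes (A₁nonempty? A i) i-occupied))
      (spreads-bound unique w∷L⊆)
    where
    i-occupied : Any (λ v → idx v ≡ i) A
    i-occupied = lose (in-A (w∷L⊆ (here refl))) (proj₂ (∈-layer⁻ (w∷L⊆ (here refl))))

  layer-bound : Unique A → length (layer i) ≤ χ (A₁nonempty? A i) + spreads (layer i)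
  layer-bound unique = sublayer-bound (layer i) (Unique.filter⁺ (λ v → idx v ≟ i) unique) id

module AcrossLayers {n : ℕ} {A : List (V (suc n))} (independent : Independent A) (3<m : 3 < suc n) where

  open Layering A

  module _ (i : Fin (suc n)) where

    private
      2<m : 2 < suc n
      2<m = <-trans (n<1+n 2) 3<m

      i≢i+2 : i ≢ i +ₘ 2
      i≢i+2 = +ₘ-no-fixpoint i 2 2<m

      i≢i+3 : i ≢ i +ₘ 3
      i≢i+3 = +ₘ-no-fixpoint i 3 3<m

      i+2≢i+3 : i +ₘ 2 ≢ i +ₘ 3
      i+2≢i+3 eq = +ₘ-no-fixpoint (i +ₘ 2) 1 (<-trans (n<1+n 1) 2<m) (trans eq (sym (+ₘ-+ₘ i 2 1)))

    z-split-excludes-y-split : Spread₂ xy z (layer i) → ¬ Spread₂ x y (layer (i +ₘ 2))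
    z-split-excludes-y-split (a , b , a∈ , b∈ , xyab , zab) (c , d , c∈ , d∈ , xcd , ycd) =
      no-edge independent (in-A a∈) (in-A b∈) (in-A c∈) (in-A d∈)
        (layers-distinct a∈ b∈ c∈ d∈ i≢i+2 (zab ∘ cong z) (ycd ∘ cong y))
        (inj₂ (inj₂ (inj₂ (same-idx a∈ b∈ , cong proj₁ (sym xyab) , cong proj₂ (sym xyab) , zab ,
          inj₂ (inj₁ (layer-shift a∈ c∈ refl , layer-shift a∈ d∈ refl , sym xcd , ycd))))))

    z-x-sums-differ : ∀ {a b c d} →
      a ∈ layer i → b ∈ layer i → c ∈ layer (i +ₘ 3) → d ∈ layer (i +ₘ 3) →
      Split xy z a b → x c ≢ x d → z a ⊕ z b ≢ x c ⊕ x d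
    z-x-sums-differ a∈ b∈ c∈ d∈ (xyab , zab) xcd sums≡ =
      no-edge independent (in-A a∈) (in-A b∈) (in-A c∈) (in-A d∈)
        (layers-distinct a∈ b∈ c∈ d∈ i≢i+3 (zab ∘ cong z) (xcd ∘ cong x))
        (inj₂ (inj₂ (inj₂ (same-idx a∈ b∈ , cong proj₁ (sym xyab) , cong proj₂ (sym xyab) , zab ,
          inj₂ (inj₂ (layer-shift a∈ c∈ refl , layer-shift a∈ d∈ refl , ≡⇒⊕≡0² sums≡))))))

    y-x-sums-differ : ∀ {a b c d} →
      a ∈ layer (i +ₘ 2) → b ∈ layer (i +ₘ 2) → c ∈ layer (i +ₘ 3) → d ∈ layer (i +ₘ 3) →
      Split x y a b → x c ≢ x d → y a ⊕ y b ≢ x c ⊕ x d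
    y-x-sums-differ a∈ b∈ c∈ d∈ (xab , yab) xcd sums≡ =
      no-edge independent (in-A a∈) (in-A b∈) (in-A c∈) (in-A d∈)
        (layers-distinct a∈ b∈ c∈ d∈ i+2≢i+3 (yab ∘ cong y) (xcd ∘ cong x))
        (inj₂ (inj₂ (inj₁ (same-idx a∈ b∈ , sym xab , layer-shift a∈ c∈ next , layer-shift a∈ d∈ next ,
          yab , ≡⇒⊕≡0² sums≡))))
      where
      next : i +ₘ 3 ≡ (i +ₘ 2) +ₘ 1
      next = sym (+ₘ-+ₘ i 2 1)

    spreads-across≤2 : z-spread (layer i) + y-spread (layer (i +ₘ 2)) + x-spread (layer (i +ₘ 3)) ≤ 2
    spreads-across≤2 = m+n+o≤2 z-or-y-vanishes
      (spreads-exclusive _≟xy_ xy z x z-x-sums-differ) (spreads-exclusive _≟²_ x y x y-x-sums-differ)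
      where
      z-or-y-vanishes : z-spread (layer i) ≡ 0 ⊎ y-spread (layer (i +ₘ 2)) ≡ 0
      z-or-y-vanishes with spread₂? _≟xy_ xy z (layer i)
      ... | yes z-split = inj₂ (spread≡0 _≟²_ x y (z-split-excludes-y-split z-split))
      ... | no ¬z-split = inj₁ (spread≡0 _≟xy_ xy z ¬z-split)

  ∑-spreads≤ : ∑[ j < suc n ] spreads (layer j) ≤ 2 * suc n
  ∑-spreads≤ = begin
    ∑[ j < suc n ] spreads (layer j)
      ≡⟨ ∑-distrib-+₃ Z Y X ⟩
    sum Z + sum Y + sum X
      ≡⟨ cong₂ (λ s t → sum Z + s + t) (∑-+ₘ 2 Y) (∑-+ₘ 3 X) ⟨
    sum Z + ∑[ j < suc n ] Y (j +ₘ 2) + ∑[ j < suc n ] X (j +ₘ 3)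
      ≡⟨ ∑-distrib-+₃ Z (λ j → Y (j +ₘ 2)) (λ j → X (j +ₘ 3)) ⟨
    ∑[ j < suc n ] (Z j + Y (j +ₘ 2) + X (j +ₘ 3))
      ≤⟨ ∑-bounded 2 spreads-across≤2 ⟩
    suc n * 2
      ≡⟨ *-comm (suc n) 2 ⟩
    2 * suc n ∎
    where
    open ≤-Reasoning
    X Y Z : Fin (suc n) → ℕ
    X j = x-spread (layer j)
    Y j = y-spread (layer j)
    Z j = z-spread (layer j)

theorem3 : (m : ℕ) → 4 ≤ m → (A : List (V m)) → Unique A → Independent A →
    length A ≤ 2 * m + occupied A
theorem3 (suc n) (s≤s 3≤n) A unique independent = begin
  length A
    ≡⟨ length-partition idx A ⟩
  ∑[ j < suc n ] length (layer j)
    ≤⟨ ∑-mono-≤ (λ j → WithinLayer.layer-bound independent j unique) ⟩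
  ∑[ j < suc n ] (occupied? j + spreads (layer j))
    ≡⟨ ∑-distrib-+ occupied? (spreads ∘ layer) ⟩
  sum occupied? + ∑[ j < suc n ] spreads (layer j)
    ≤⟨ +-monoʳ-≤ (sum occupied?) (AcrossLayers.∑-spreads≤ independent (s≤s 3≤n)) ⟩
  sum occupied? + 2 * suc n
    ≡⟨ +-comm (sum occupied?) (2 * suc n) ⟩
  2 * suc n + sum occupied?
    ≡⟨ cong (2 * suc n +_) (sum-map-allFin occupied?) ⟨
  2 * suc n + occupied A ∎
  where
  open ≤-Reasoning
  open Layering A
  occupied? : Fin (suc n) → ℕ
  occupied? j = χ (A₁nonempty? A j)
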